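{- Let $r\ge 2$ and $t\ge 1$ be integers, let $T$ be an $r$-tree with $(r-1)t+1$ vertices, and let $G$ be an $r$-graph that does not contain a copy of $T$. Then the chromatic number of $G$ is at most $2(r-1)(t-1)+1$.
   Context: An $r$-graph is a hypergraph all of whose edges have exactly $r$ vertices; containing a copy of $T$ means containing $T$ as a (not necessarily induced) subhypergraph. A cycle of length $t\ge 2$ in an $r$-graph consists of $t$ distinct vertices $x_1,\ldots,x_t$ and $t$ distinct edges $E_1,\ldots,E_t$ with $\{x_i,x_{i+1}\}\subseteq E_i$ for each $i$ (indices mod $t$). An $r$-forest is an $r$-graph with no cycles. An $r$-graph is connected if for every two vertices $x,y$ there are edges $E_1,\ldots,E_l$ with $x\in E_1$, $y\in E_l$ and $E_i\cap E_{i+1}\ne\emptyset$ for all $i$. An $r$-tree is a connected $r$-forest (so an $r$-tree with $(r-1)t+1$ vertices has $t$ edges). The chromatic number is the minimum number of colors in a vertex coloring with no monochromatic edge. -}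

module Defs where

open import Data.Nat using (ℕ; zero; suc; _+_; _*_; _∸_; _≤_; _<_; _%_)
open import Data.Nat.DivMod using (m%n<n)
open import Data.Fin using (Fin; toℕ; fromℕ<; fromℕ; inject₁)
open import Data.Fin as F using ()
open import Data.Product using (Σ; ∃; _×_; _,_)
open import Relation.Binary.PropositionalEquality using (_≡_; _≢_)
open import Relation.Nullary using (¬_)
open import Function.Definitions using (Injective)
open import Function.Bundles using (_⇔_)

-- A finite r-graph: vertex set Fin n, edges indexed by Fin m; each edge is
-- given by an injective enumeration Fin r → Fin n of its r vertices, and
-- distinct edge indices give distinct vertex sets (no repeated edges).
record Hypergraph (r : ℕ) : Set where
  field
    n        : ℕ
    m        : ℕ
    edge     : Fin m → Fin r → Fin n
    edge-inj : ∀ e → Injective _≡_ _≡_ (edge e)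

  _∈E_ : Fin n → Fin m → Set
  v ∈E e = ∃ λ i → edge e i ≡ v

  field
    edges-distinct : ∀ e f → e ≢ f → ¬ (∀ v → (v ∈E e) ⇔ (v ∈E f))

open Hypergraph public

next : ∀ {k} → Fin (suc k) → Fin (suc k)
next {k} i = fromℕ< (m%n<n (suc (toℕ i)) (suc k))

-- A cycle of length t = suc (suc k) ≥ 2: distinct vertices x_i, distinct
-- edges E_i with {x_i, x_{i+1}} ⊆ E_i (indices mod t).
record Cycle {r : ℕ} (H : Hypergraph r) (k : ℕ) : Set where
  field
    x     : Fin (suc (suc k)) → Fin (n H)
    E     : Fin (suc (suc k)) → Fin (m H)
    x-inj : Injective _≡_ _≡_ x
    E-inj : Injective _≡_ _≡_ E
    here  : ∀ i → _∈E_ H (x i) (E i)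
    there : ∀ i → _∈E_ H (x (next i)) (E i)

IsForest : ∀ {r} → Hypergraph r → Set
IsForest H = ∀ k → ¬ Cycle H k

record EdgeWalk {r : ℕ} (H : Hypergraph r) (x y : Fin (n H)) : Set where
  field
    l      : ℕ
    E      : Fin (suc l) → Fin (m H)
    start  : _∈E_ H x (E F.zero)
    end    : _∈E_ H y (E (fromℕ l))
    linked : ∀ (i : Fin l) → ∃ λ v →
               _∈E_ H v (E (inject₁ i)) × _∈E_ H v (E (F.suc i))

IsConnected : ∀ {r} → Hypergraph r → Set
IsConnected H = ∀ x y → EdgeWalk H x y

IsTree : ∀ {r} → Hypergraph r → Set
IsTree H = IsConnected H × IsForest H

-- G contains a copy of T: an injective vertex map sending every edge of T
-- into (hence, both being r-sets, onto) some edge of G.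
Contains : ∀ {r} → Hypergraph r → Hypergraph r → Set
Contains G T =
  Σ (Fin (n T) → Fin (n G)) λ φ →
    Injective _≡_ _≡_ φ ×
    (∀ e → ∃ λ f → ∀ i → _∈E_ G (φ (edge T e i)) f)

ProperColouring : ∀ {r} → Hypergraph r → ℕ → Set
ProperColouring H K =
  Σ (Fin (n H) → Fin K) λ c →
    ∀ e → ¬ (∀ i j → c (edge H e i) ≡ c (edge H e j))

ChromaticAtMost : ∀ {r} → Hypergraph r → ℕ → Set
ChromaticAtMost H K = ProperColouring H K

module Submission where

-- In fact D + 1 colours suffice, where D = (r-1)(t-1).  Call a vertex v of a vertex set S
-- D-pinned if at most D vertices block it, i.e. every edge of G[S] through v has another
-- vertex among them.  If every nonempty S has a D-pinned vertex, colouring S minus that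
-- vertex first and then v with a colour missing on its blockers gives D + 1 colours.
-- Pinned vertices exist in T-free graphs: grow a copy of T inside G[S] greedily, one edge at
-- a time, starting anywhere.  Connectivity and acyclicity of T give an edge f of T meeting
-- the copied subtree in exactly one vertex a.  Either some edge of G[S] through the image of
-- a avoids the rest of the copy, and f is copied onto it, or the images of the other copied
-- vertices (at most (r-1)(t-1) of them, since the subtree is smaller than T) pin the image
-- of a.  As G is T-free the copy never becomes complete, so a pinned vertex appears.

open import Defs
open import Data.Nat using (ℕ; suc; _+_; _*_; _∸_; _≤_)
open import Relation.Nullary using (¬_)
open import Relation.Binary.PropositionalEquality using (_≡_)

open import Data.Nat using (zero; _<_; s≤s; z≤n)
import Data.Nat.Properties as ℕP
open import Data.Nat.DivMod using (_%_; m<n⇒m%n≡m; n%n≡0)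
open import Data.Fin as Fin using (Fin; toℕ; fromℕ; fromℕ<; inject₁; punchIn)
import Data.Fin.Properties as FinP
open FinP using (_≟_)
import Data.Vec.Functional as Vec
open Vec using (Vector)
open import Data.List using (List; []; _∷_; length; map; filter; allFin; _++_)
open import Data.List.Properties using (filter-notAll; length-map; length-tabulate; length-++)
open import Data.List.Membership.Propositional using (_∈_; _∉_)
open import Data.List.Membership.Propositional.Properties
  using (∈-filter⁺; ∈-allFin; ∈-map⁺; ∈-map⁻; ∈-++⁺ˡ; ∈-++⁺ʳ; ∈-++⁻)
open import Data.List.Membership.Setoid.Properties using (index-injective)
open import Data.List.Relation.Unary.Any as Any using (here; there)
open import Data.List.Relation.Unary.All as All using (All; []; _∷_)
open import Data.List.Relation.Unary.AllPairs using ([]; _∷_)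
open import Data.List.Relation.Unary.Unique.Propositional using (Unique)
import Data.List.Relation.Unary.Unique.Propositional.Properties as Unique
open import Data.Product using (Σ; ∃; _×_; _,_)
open import Data.Sum using (_⊎_; inj₁; inj₂)
open import Data.Empty using (⊥; ⊥-elim)
open import Relation.Binary.PropositionalEquality
  using (_≢_; refl; sym; trans; cong; cong₂; subst; subst₂; setoid; module ≡-Reasoning)
open import Relation.Nullary using (Dec; yes; no; ¬?)
open import Relation.Nullary.Decidable using (_×-dec_; _⊎-dec_; decidable-stable)
open import Relation.Unary using (Decidable)
open import Function.Definitions using (Injective)

_∈?_ : ∀ {k} (x : Fin k) (xs : List (Fin k)) → Dec (x ∈ xs)
x ∈? xs = Any.any? (x ≟_) xs

data LastView {k : ℕ} : Fin (suc k) → Set where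
  initial : (j : Fin k) → LastView (inject₁ j)
  final   : LastView (fromℕ k)

lastView : ∀ {k} (i : Fin (suc k)) → LastView i
lastView {zero}  Fin.zero    = final
lastView {suc k} Fin.zero    = initial Fin.zero
lastView {suc k} (Fin.suc i) with lastView i
... | initial j = initial (Fin.suc j)
... | final     = final

-- snoc xs x extends the sequence xs by x at the end (Data.Vec.Functional only has _∷_,
-- which extends at the front); paths are extended at both ends.
snoc : ∀ {A : Set} {k} → Vector A k → A → Vector A (suc k)
snoc {k = zero}  xs x = λ _ → x
snoc {k = suc k} xs x = Vec.head xs Vec.∷ snoc (Vec.tail xs) x

snoc-initial : ∀ {A : Set} {k} (xs : Vector A k) x j → snoc xs x (inject₁ j) ≡ xs j
snoc-initial {k = suc k} xs x Fin.zero    = refl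
snoc-initial {k = suc k} xs x (Fin.suc j) = snoc-initial (Vec.tail xs) x j

snoc-final : ∀ {A : Set} {k} (xs : Vector A k) x → snoc xs x (fromℕ k) ≡ x
snoc-final {k = zero}  xs x = refl
snoc-final {k = suc k} xs x = snoc-final (Vec.tail xs) x

snoc-all : ∀ {A : Set} {k} (P : A → Set) (xs : Vector A k) x →
  (∀ j → P (xs j)) → P x → ∀ i → P (snoc xs x i)
snoc-all P xs x all-xs px i with lastView i
... | initial j = subst P (sym (snoc-initial xs x j)) (all-xs j)
... | final     = subst P (sym (snoc-final xs x)) px

snoc-injective : ∀ {A : Set} {k} (xs : Vector A k) x → Injective _≡_ _≡_ xs →
  (∀ j → xs j ≢ x) → Injective _≡_ _≡_ (snoc xs x)
snoc-injective xs x xs-inj fresh {i} {i′} eq with lastView i | lastView i′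
... | initial j | initial j′ =
  cong inject₁ (xs-inj (trans (sym (snoc-initial xs x j)) (trans eq (snoc-initial xs x j′))))
... | initial j | final =
  ⊥-elim (fresh j (trans (sym (snoc-initial xs x j)) (trans eq (snoc-final xs x))))
... | final | initial j′ =
  ⊥-elim (fresh j′ (trans (sym (snoc-initial xs x j′)) (trans (sym eq) (snoc-final xs x))))
... | final | final = refl

∷-injective : ∀ {A : Set} {k} (x : A) (xs : Vector A k) → Injective _≡_ _≡_ xs →
  (∀ j → xs j ≢ x) → Injective _≡_ _≡_ (x Vec.∷ xs)
∷-injective x xs xs-inj fresh {Fin.zero}  {Fin.zero}   eq = refl
∷-injective x xs xs-inj fresh {Fin.zero}  {Fin.suc j}  eq = ⊥-elim (fresh j (sym eq))
∷-injective x xs xs-inj fresh {Fin.suc i} {Fin.zero}   eq = ⊥-elim (fresh i eq)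
∷-injective x xs xs-inj fresh {Fin.suc i} {Fin.suc j}  eq = cong Fin.suc (xs-inj eq)

next-inject₁ : ∀ {k} (j : Fin (suc k)) → next {suc k} (inject₁ j) ≡ Fin.suc j
next-inject₁ {k} j = FinP.toℕ-injective (trans (FinP.toℕ-fromℕ< _)
  (trans (m<n⇒m%n≡m (s≤s (subst (_< suc k) (sym (FinP.toℕ-inject₁ j)) (FinP.toℕ<n j))))
         (cong suc (FinP.toℕ-inject₁ j))))

next-final : ∀ k → next {suc k} (fromℕ (suc k)) ≡ Fin.zero
next-final k = FinP.toℕ-injective (trans (FinP.toℕ-fromℕ< _)
  (trans (cong (λ z → suc (suc z) % suc (suc k)) (FinP.toℕ-fromℕ k)) (n%n≡0 (suc (suc k)))))

data PunchView {k : ℕ} (i₀ : Fin (suc k)) : Fin (suc k) → Set where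
  pivot : PunchView i₀ i₀
  other : (j : Fin k) → PunchView i₀ (punchIn i₀ j)

punchView : ∀ {k} (i₀ i : Fin (suc k)) → PunchView i₀ i
punchView i₀ i with i₀ ≟ i
... | yes refl = pivot
... | no  i₀≢i = subst (PunchView i₀) (FinP.punchIn-punchOut i₀≢i) (other (Fin.punchOut i₀≢i))

module _ {r : ℕ} (H : Hypergraph r) where
  private
    V = Fin (n H)
    E = Fin (m H)
    _∈H_ = _∈E_ H

  -- A path with k+1 edges from a to b: distinct vertices a = vx 0, …, vx (k+1) = b and
  -- distinct edges ed 0, …, ed k such that ed j contains vx j and vx (j+1).
  record Path (a b : V) (k : ℕ) : Set where
    field
      vx       : Vector V (suc (suc k))
      ed       : Vector E (suc k)
      vx-first : vx Fin.zero ≡ a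
      vx-last  : vx (fromℕ (suc k)) ≡ b
      vx-inj   : Injective _≡_ _≡_ vx
      ed-inj   : Injective _≡_ _≡_ ed
      left     : ∀ j → vx (inject₁ j) ∈H ed j
      right    : ∀ j → vx (Fin.suc j) ∈H ed j

    vx-on-edge : ∀ i → ∃ λ j → vx i ∈H ed j
    vx-on-edge i with lastView i
    ... | initial j = j , left j
    ... | final     = fromℕ k , right (fromℕ k)

  open Path public

  edge-path : ∀ {a b} e → a ∈H e → b ∈H e → a ≢ b → Path a b 0
  edge-path {a} {b} e a∈e b∈e a≢b = record
    { vx = a Vec.∷ b Vec.∷ Vec.[] ; ed = λ _ → e ; vx-first = refl ; vx-last = refl
    ; vx-inj = ∷-injective a _ (∷-injective b Vec.[] (λ {}) (λ ()))
                 (λ { Fin.zero b≡a → a≢b (sym b≡a) })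
    ; ed-inj = λ { {Fin.zero} {Fin.zero} _ → refl }
    ; left = λ { Fin.zero → a∈e } ; right = λ { Fin.zero → b∈e } }

  prepend : ∀ {a b k} x e (q : Path a b k) → x ∈H e → a ∈H e →
    (∀ i → vx q i ≢ x) → (∀ j → ed q j ≢ e) → Path x b (suc k)
  prepend x e q x∈e a∈e x-new e-new = record
    { vx = x Vec.∷ vx q ; ed = e Vec.∷ ed q ; vx-first = refl ; vx-last = vx-last q
    ; vx-inj = ∷-injective x (vx q) (vx-inj q) x-new
    ; ed-inj = ∷-injective e (ed q) (ed-inj q) e-new
    ; left = λ { Fin.zero → x∈e ; (Fin.suc j) → left q j }
    ; right = λ { Fin.zero → subst (_∈H e) (sym (vx-first q)) a∈e ; (Fin.suc j) → right q j } }

  append : ∀ {a b k} (q : Path a b k) e x → b ∈H e → x ∈H e →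
    (∀ i → vx q i ≢ x) → (∀ j → ed q j ≢ e) → Path a x (suc k)
  append {k = k} q e x b∈e x∈e x-new e-new = record
    { vx = snoc (vx q) x ; ed = snoc (ed q) e ; vx-first = vx-first q
    ; vx-last = snoc-final (vx q) x
    ; vx-inj = snoc-injective (vx q) x (vx-inj q) x-new
    ; ed-inj = snoc-injective (ed q) e (ed-inj q) e-new
    ; left = left′ ; right = right′ }
    where
    left′ : ∀ j → snoc (vx q) x (inject₁ j) ∈H snoc (ed q) e j
    left′ j with lastView j
    ... | initial i = subst₂ _∈H_ (sym (snoc-initial (vx q) x (inject₁ i)))
                        (sym (snoc-initial (ed q) e i)) (left q i)
    ... | final     = subst₂ _∈H_ (sym (trans (snoc-initial (vx q) x (fromℕ (suc k))) (vx-last q)))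
                        (sym (snoc-final (ed q) e)) b∈e
    right′ : ∀ j → snoc (vx q) x (Fin.suc j) ∈H snoc (ed q) e j
    right′ j with lastView j
    ... | initial i = subst₂ _∈H_ (sym (snoc-initial (vx q) x (Fin.suc i)))
                        (sym (snoc-initial (ed q) e i)) (right q i)
    ... | final     = subst₂ _∈H_ (sym (snoc-final (vx q) x)) (sym (snoc-final (ed q) e)) x∈e

  close-path : ∀ {a b k} (q : Path a b k) f → a ∈H f → b ∈H f → (∀ j → ed q j ≢ f) → Cycle H k
  close-path {a} {b} {k} q f a∈f b∈f f-new = record
    { x = vx q ; E = snoc (ed q) f ; x-inj = vx-inj q
    ; E-inj = snoc-injective (ed q) f (ed-inj q) f-new
    ; here = here′ ; there = there′ }
    where
    here′ : ∀ i → vx q i ∈H snoc (ed q) f i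
    here′ i with lastView i
    ... | initial j = subst (vx q (inject₁ j) ∈H_) (sym (snoc-initial (ed q) f j)) (left q j)
    ... | final     = subst₂ _∈H_ (sym (vx-last q)) (sym (snoc-final (ed q) f)) b∈f
    there′ : ∀ i → vx q (next i) ∈H snoc (ed q) f i
    there′ i with lastView i
    ... | initial j = subst₂ _∈H_ (cong (vx q) (sym (next-inject₁ j)))
                        (sym (snoc-initial (ed q) f j)) (right q j)
    ... | final     = subst₂ _∈H_ (trans (sym (vx-first q)) (cong (vx q) (sym (next-final k))))
                        (sym (snoc-final (ed q) f)) a∈f

  forest-chord : IsForest H → ∀ {a b k} (q : Path a b k) {f} → a ∈H f → b ∈H f →
    ∃ λ j → ed q j ≡ f
  forest-chord forest {k = k} q {f} a∈f b∈f with FinP.any? (λ j → ed q j ≟ f)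
  ... | yes on-path = on-path
  ... | no  off     = ⊥-elim (forest k (close-path q f a∈f b∈f (λ j eq → off (j , eq))))

  crossing-edge : ∀ (P : V → Set) → Decidable P → ∀ {x y} → EdgeWalk H x y → P x → ¬ P y →
    ∃ λ f → (∃ λ i → P (edge H f i)) × (∃ λ j → ¬ P (edge H f j))
  crossing-edge P P? w Px ¬Py =
    crossing (EdgeWalk.E w) (EdgeWalk.linked w)
      (let (i , eq) = EdgeWalk.start w in i , subst P (sym eq) Px)
      (let (j , eq) = EdgeWalk.end w in j , λ Pe → ¬Py (subst P eq Pe))
    where
    -- Scan the edges in order: the first edge not entirely inside P is the crossing one.
    crossing : ∀ {l} (Es : Vector E (suc l)) →
      (∀ (i : Fin l) → ∃ λ v → v ∈H Es (inject₁ i) × v ∈H Es (Fin.suc i)) →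
      (∃ λ i → P (edge H (Es Fin.zero) i)) → (∃ λ j → ¬ P (edge H (Es (fromℕ l)) j)) →
      ∃ λ f → (∃ λ i → P (edge H f i)) × (∃ λ j → ¬ P (edge H f j))
    crossing {zero}  Es linked inside outside = Es Fin.zero , inside , outside
    crossing {suc l} Es linked inside outside with FinP.all? (λ i → P? (edge H (Es Fin.zero) i))
    ... | no  partial =
      Es Fin.zero , inside , FinP.¬∀⟶∃¬ _ _ (λ i → P? (edge H (Es Fin.zero) i)) partial
    ... | yes full    =
      let (v , (i , eqᵢ) , (j , eqⱼ)) = linked Fin.zero
      in crossing (Vec.tail Es) (λ i → linked (Fin.suc i))
           (j , subst P (sym eqⱼ) (subst P eqᵢ (full i))) outside

module _ {k : ℕ} where

  remove : Fin k → List (Fin k) → List (Fin k)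
  remove x = filter (λ u → ¬? (u ≟ x))

  remove-shorter : ∀ {x xs} → x ∈ xs → length (remove x xs) < length xs
  remove-shorter {x} {xs} x∈xs =
    filter-notAll (λ u → ¬? (u ≟ x)) xs (Any.map (λ u≡x u≢x → u≢x (sym u≡x)) x∈xs)

  ∈-remove⁺ : ∀ {x y xs} → y ∈ xs → y ≢ x → y ∈ remove x xs
  ∈-remove⁺ = ∈-filter⁺ (λ u → ¬? (u ≟ _))

  unique-⊆-length : ∀ {xs ys : List (Fin k)} → Unique xs → All (_∈ ys) xs → length xs ≤ length ys
  unique-⊆-length {[]}     _             _              = z≤n
  unique-⊆-length {x ∷ xs} {ys} (x∉xs ∷ xs!) (x∈ys ∷ xs⊆ys) =
    ℕP.≤-trans (s≤s (unique-⊆-length xs! (still-inside x∉xs xs⊆ys))) (remove-shorter x∈ys)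
    where
    still-inside : ∀ {zs} → All (x ≢_) zs → All (_∈ ys) zs → All (_∈ remove x ys) zs
    still-inside []           []            = []
    still-inside (x≢z ∷ x≢zs) (z∈ys ∷ zs⊆ys) =
      ∈-remove⁺ z∈ys (λ z≡x → x≢z (sym z≡x)) ∷ still-inside x≢zs zs⊆ys

  unique-length : ∀ {xs : List (Fin k)} → Unique xs → length xs ≤ k
  unique-length {xs} xs! = subst (length xs ≤_) (length-tabulate (λ i → i))
    (unique-⊆-length xs! (All.tabulate (λ {x} _ → ∈-allFin x)))

-- Fewer than K colours leave some colour unused: otherwise the position of each colour
-- in the list would inject Fin K into Fin (length L).
missing-colour : ∀ {K} (L : List (Fin K)) → length L < K → ∃ λ c → c ∉ L
missing-colour {K} L L<K with FinP.any? (λ c → ¬? (c ∈? L))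
... | yes missing = missing
... | no  none    = ⊥-elim (ℕP.<⇒≱ L<K (FinP.injective⇒≤ position-injective))
  where
  listed : ∀ c → c ∈ L
  listed c = decidable-stable (c ∈? L) (λ c∉L → none (c , c∉L))
  position-injective : ∀ {c d} → Any.index (listed c) ≡ Any.index (listed d) → c ≡ d
  position-injective = index-injective (setoid (Fin K)) (listed _) (listed _)

module _ {r : ℕ} (G : Hypergraph (suc r)) where
  private
    V = Fin (n G)

  Inside : List V → Fin (m G) → Set
  Inside S g = ∀ i → edge G g i ∈ S

  Blocks : List V → V → List V → Set
  Blocks S v W = ∀ g → Inside S g → _∈E_ G v g → ∃ λ j → edge G g j ≢ v × edge G g j ∈ W

  Pinned : ℕ → List V → V → Set
  Pinned D S v = ∃ λ W → length W ≤ D × Blocks S v W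

  Degenerate : ℕ → Set
  Degenerate D = ∀ S {v₀} → v₀ ∈ S → ∃ λ v → v ∈ S × Pinned D S v

  ProperOn : ∀ {K} → List V → (V → Fin K) → Set
  ProperOn S c = ∀ g → Inside S g → ¬ (∀ i j → c (edge G g i) ≡ c (edge G g j))

  recolour : ∀ {K} → (V → Fin K) → V → Fin K → V → Fin K
  recolour c v col u with u ≟ v
  ... | yes _ = col
  ... | no  _ = c u

  recolour-at : ∀ {K} (c : V → Fin K) v col {u} → u ≡ v → recolour c v col u ≡ col
  recolour-at c v col {u} u≡v with u ≟ v
  ... | yes _   = refl
  ... | no  u≢v = ⊥-elim (u≢v u≡v)

  recolour-away : ∀ {K} (c : V → Fin K) v col {u} → u ≢ v → recolour c v col u ≡ c u
  recolour-away c v col {u} u≢v with u ≟ v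
  ... | yes u≡v = ⊥-elim (u≢v u≡v)
  ... | no  _   = refl

  -- Colour S greedily: colour S minus a pinned vertex v first, then give v a colour
  -- missing on its at most D blockers.  The fuel N bounds the length of S.
  greedy : ∀ {D K} → Degenerate D → D < K → ∀ N S → length S ≤ N → Σ (V → Fin K) (ProperOn S)
  greedy deg D<K N [] _ = (λ _ → fromℕ< D<K) , λ g inside _ → nowhere (inside Fin.zero)
    where
    nowhere : ∀ {u : V} → u ∉ []
    nowhere ()
  greedy deg D<K zero (_ ∷ _) ()
  greedy {K = K} deg D<K (suc N) S@(_ ∷ _) (s≤s |S|≤N)
    with deg S (Any.here refl)
  ... | v , v∈S , W , |W|≤D , blocks
    with greedy deg D<K N (remove v S) (ℕP.≤-trans (ℕP.≤-pred (remove-shorter v∈S)) |S|≤N)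
  ... | c , proper
    with missing-colour (map c W) (subst (_< K) (sym (length-map c W)) (ℕP.≤-<-trans |W|≤D D<K))
  ... | col , col∉cW = recolour c v col , proper′
    where
    proper′ : ProperOn S (recolour c v col)
    proper′ g inside mono with FinP.any? (λ i → edge G g i ≟ v)
    ... | yes v∈g@(i , eᵢ≡v) =
      let (j , eⱼ≢v , eⱼ∈W) = blocks g inside v∈g
      in col∉cW (subst (_∈ map c W)
           (trans (sym (recolour-away c v col eⱼ≢v))
             (trans (sym (mono i j)) (recolour-at c v col eᵢ≡v)))
           (∈-map⁺ c eⱼ∈W))
    ... | no  v∉g = proper g (λ i → ∈-remove⁺ (inside i) (λ eᵢ≡v → v∉g (i , eᵢ≡v)))
      (λ i j → trans (sym (recolour-away c v col (λ eᵢ≡v → v∉g (i , eᵢ≡v))))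
                 (trans (mono i j) (recolour-away c v col (λ eⱼ≡v → v∉g (j , eⱼ≡v)))))

  degenerate-colourable : ∀ {D K} → Degenerate D → D < K → ProperColouring G K
  degenerate-colourable deg D<K
    with greedy deg D<K (n G) (allFin (n G)) (ℕP.≤-reflexive (length-tabulate (λ i → i)))
  ... | c , proper = c , λ g → proper g (λ i → ∈-allFin _)

-- Greedy embedding of the tree T into G[S], started at an arbitrary vertex v₀ of S.  Edges
-- have r = r₂ + 2 ≥ 2 vertices, so that every edge of T joins two distinct vertices.
module TreeGrowth {r₂ : ℕ} (T G : Hypergraph (suc (suc r₂))) (t : ℕ)
  (connected : IsConnected T) (forest : IsForest T) (size : n T ≡ suc r₂ * t + 1)
  (S : List (Fin (n G))) (v₀ : Fin (n G)) (v₀∈S : v₀ ∈ S) where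

  private
    r₁ = suc r₂
    VT = Fin (n T)
    ET = Fin (m T)
    VG = Fin (n G)
    _∈T_ = _∈E_ T
    _∈G_ = _∈E_ G

  -- The bound on blocking sets: r₁ (t - 1) = (r - 1)(t - 1).
  D : ℕ
  D = r₁ * (t ∸ 1)

  root : VT
  root = subst Fin (sym (trans size (ℕP.+-comm (r₁ * t) 1))) Fin.zero

  UsedPath : List ET → VT → VT → Set
  UsedPath used a b = ∃ λ k → Σ (Path T a b k) λ q → ∀ j → ed q j ∈ used

  record PartialCopy (p : ℕ) : Set where
    field
      dom         : List VT
      dom-unique  : Unique dom
      dom-size    : length dom ≡ suc (r₁ * p)
      root∈dom    : root ∈ dom
      φ           : VT → VG
      φ-inj       : ∀ {a b} → a ∈ dom → b ∈ dom → φ a ≡ φ b → a ≡ b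
      φ-into-S    : ∀ {a} → a ∈ dom → φ a ∈ S
      used        : List ET
      used-inside : ∀ {e} → e ∈ used → ∀ i → edge T e i ∈ dom
      used-copied : ∀ {e} → e ∈ used → ∃ λ g → ∀ i → φ (edge T e i) ∈G g
      used-linked : ∀ {a b} → a ∈ dom → b ∈ dom → a ≢ b → UsedPath used a b

  initial-copy : PartialCopy 0
  initial-copy = record
    { dom = root ∷ [] ; dom-unique = [] ∷ [] ; dom-size = cong suc (sym (ℕP.*-zeroʳ r₁))
    ; root∈dom = here refl ; φ = λ _ → v₀
    ; φ-inj = λ { (here refl) (here refl) _ → refl }
    ; φ-into-S = λ { (here refl) → v₀∈S }
    ; used = [] ; used-inside = λ () ; used-copied = λ ()
    ; used-linked = λ { (here refl) (here refl) a≢a → ⊥-elim (a≢a refl) } }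

  Outcome : Set
  Outcome = Contains G T ⊎ (∃ λ v → v ∈ S × Pinned G D S v)

  module _ {p : ℕ} (π : PartialCopy p) where
    open PartialCopy π

    -- By acyclicity, an edge outside used meets dom in at most one vertex.
    no-chord : ∀ f → f ∉ used → ∀ {a b} → a ∈ dom → b ∈ dom → a ≢ b → a ∈T f → b ∈T f → ⊥
    no-chord f f∉used a∈dom b∈dom a≢b a∈f b∈f with used-linked a∈dom b∈dom a≢b
    ... | _ , q , q-used with forest-chord T forest q a∈f b∈f
    ... | j , edⱼ≡f = f∉used (subst (_∈ used) edⱼ≡f (q-used j))

    complete-copy : (∀ y → y ∈ dom) → Contains G T
    complete-copy everywhere = φ , (λ {a} {b} → φ-inj (everywhere a) (everywhere b)) , copied
      where
      two-ends : ∀ e → edge T e Fin.zero ≢ edge T e (Fin.suc Fin.zero)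
      two-ends e eq with edge-inj T e eq
      ... | ()
      copied : ∀ e → ∃ λ g → ∀ i → φ (edge T e i) ∈G g
      copied e with e ∈? used
      ... | yes e∈used = used-copied e∈used
      ... | no  e∉used = ⊥-elim (no-chord e e∉used (everywhere _) (everywhere _) (two-ends e)
                                   (Fin.zero , refl) (Fin.suc Fin.zero , refl))

    record Frontier : Set where
      field
        f        : ET
        i₀       : Fin (suc r₁)
        attached : edge T f i₀ ∈ dom
        detached : ∀ i → i ≢ i₀ → edge T f i ∉ dom

    -- If dom misses a vertex, connectivity yields an edge leaving dom, and acyclicity
    -- shows that it meets dom only once.
    find-frontier : ¬ (∀ y → y ∈ dom) → Frontier
    find-frontier incomplete
      with FinP.¬∀⟶∃¬ _ _ (λ y → y ∈? dom) incomplete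
    ... | y , y∉dom
      with crossing-edge T (_∈ dom) (_∈? dom) (connected root y) root∈dom y∉dom
    ... | f , (i₀ , attached) , (j , eⱼ∉dom) = record
      { f = f ; i₀ = i₀ ; attached = attached
      ; detached = λ i i≢i₀ eᵢ∈dom → no-chord f (λ f∈used → eⱼ∉dom (used-inside f∈used j))
                     attached eᵢ∈dom (λ eq → i≢i₀ (sym (edge-inj T f eq))) (i₀ , refl) (i , refl) }

    path-in-dom : ∀ {a b k} (q : Path T a b k) → (∀ j → ed q j ∈ used) → ∀ i → vx q i ∈ dom
    path-in-dom q q-used i =
      let (j , (l , eₗ≡v)) = vx-on-edge q i
      in subst (_∈ dom) eₗ≡v (used-inside (q-used j) l)

    module Attach (fr : Frontier) where
      open Frontier fr

      a : VT
      a = edge T f i₀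

      new : Fin r₁ → VT
      new j = edge T f (punchIn i₀ j)

      new-inj : ∀ {j j′} → new j ≡ new j′ → j ≡ j′
      new-inj eq = FinP.punchIn-injective i₀ _ _ (edge-inj T f eq)

      new∉dom : ∀ j → new j ∉ dom
      new∉dom j = detached (punchIn i₀ j) (FinP.punchInᵢ≢i i₀ j)

      f∉used : f ∉ used
      f∉used f∈used = new∉dom Fin.zero (used-inside f∈used _)

      news : List VT
      news = map new (allFin r₁)

      ∈-news⁺ : ∀ j → new j ∈ news
      ∈-news⁺ j = ∈-map⁺ new (∈-allFin j)

      dom′ : List VT
      dom′ = news ++ dom

      data Placed : VT → Set where
        fresh : ∀ j → Placed (new j)
        old   : ∀ {u} → u ∈ dom → Placed u

      placed : ∀ {u} → u ∈ dom′ → Placed u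
      placed u∈dom′ with ∈-++⁻ news u∈dom′
      ... | inj₂ u∈dom = old u∈dom
      ... | inj₁ u∈news with ∈-map⁻ new u∈news
      ...   | j , _ , refl = fresh j

      dom′-unique : Unique dom′
      dom′-unique = Unique.++⁺ (Unique.map⁺ new-inj (Unique.allFin⁺ r₁)) dom-unique
        λ (u∈news , u∈dom) → let (j , _ , u≡newⱼ) = ∈-map⁻ new u∈news
                              in new∉dom j (subst (_∈ dom) u≡newⱼ u∈dom)

      dom′-size : length dom′ ≡ suc (r₁ * suc p)
      dom′-size = begin
        length (news ++ dom)          ≡⟨ length-++ news ⟩
        length news + length dom      ≡⟨ cong₂ _+_ (trans (length-map new (allFin r₁))
                                                        (length-tabulate (λ j → j))) dom-size ⟩
        r₁ + suc (r₁ * p)             ≡⟨ ℕP.+-suc r₁ (r₁ * p) ⟩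
        suc (r₁ + r₁ * p)             ≡⟨ cong suc (sym (ℕP.*-suc r₁ p)) ⟩
        suc (r₁ * suc p)              ∎
        where open ≡-Reasoning

      -- The enlarged vertex set still fits into T, so p + 1 ≤ t.
      room : suc p ≤ t
      room = ℕP.*-cancelˡ-≤ r₁ (ℕP.≤-pred
        (subst₂ _≤_ dom′-size (trans size (ℕP.+-comm (r₁ * t) 1)) (unique-length dom′-unique)))

      Receives : Fin (m G) → Set
      Receives g = Inside G S g × φ a ∈G g × (∀ i → edge G g i ≡ φ a ⊎ edge G g i ∉ map φ dom)

      receives? : ∀ g → Dec (Receives g)
      receives? g = FinP.all? (λ i → edge G g i ∈? S)
        ×-dec (FinP.any? (λ i → edge G g i ≟ φ a)
        ×-dec FinP.all? (λ i → (edge G g i ≟ φ a) ⊎-dec ¬? (edge G g i ∈? map φ dom)))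

      -- If no edge receives f, the images of dom minus a block φ a, and there are at most
      -- r₁ p ≤ D of them.
      pinned : ¬ (∃ Receives) → Pinned G D S (φ a)
      pinned none = map φ (remove a dom) , blockers-size , blocks
        where
        blockers-size : length (map φ (remove a dom)) ≤ D
        blockers-size = subst (_≤ D) (sym (length-map φ (remove a dom)))
          (ℕP.≤-trans (ℕP.≤-pred (subst (length (remove a dom) <_) dom-size (remove-shorter attached)))
                      (ℕP.*-monoʳ-≤ r₁ (ℕP.∸-monoˡ-≤ 1 room)))
        blocks : Blocks G S (φ a) (map φ (remove a dom))
        blocks g g-inside φa∈g
          with FinP.¬∀⟶∃¬ _ _ (λ i → (edge G g i ≟ φ a) ⊎-dec ¬? (edge G g i ∈? map φ dom))
                 (λ avoids → none (g , g-inside , φa∈g , avoids))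
        ... | j , ¬avoidsⱼ
          with ∈-map⁻ φ (decidable-stable (edge G g j ∈? map φ dom) (λ ∉ → ¬avoidsⱼ (inj₂ ∉)))
        ... | u , u∈dom , eⱼ≡φu = j , (λ eⱼ≡φa → ¬avoidsⱼ (inj₁ eⱼ≡φa)) ,
          subst (_∈ map φ (remove a dom)) (sym eⱼ≡φu) (∈-map⁺ φ (∈-remove⁺ u∈dom
            (λ u≡a → ¬avoidsⱼ (inj₁ (trans eⱼ≡φu (cong φ u≡a))))))

      module Extend (g : Fin (m G)) (g-inside : Inside G S g) (k₀ : Fin (suc r₁))
                    (gk₀≡φa : edge G g k₀ ≡ φ a)
                    (g-avoids : ∀ i → edge G g i ≡ φ a ⊎ edge G g i ∉ map φ dom) where

        new′ : Fin r₁ → VG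
        new′ j = edge G g (punchIn k₀ j)

        new′-inj : ∀ {j j′} → new′ j ≡ new′ j′ → j ≡ j′
        new′-inj eq = FinP.punchIn-injective k₀ _ _ (edge-inj G g eq)

        new′∉image : ∀ j {b} → b ∈ dom → new′ j ≢ φ b
        new′∉image j b∈dom eq with g-avoids (punchIn k₀ j)
        ... | inj₁ new′ⱼ≡φa = FinP.punchInᵢ≢i k₀ j (edge-inj G g (trans new′ⱼ≡φa (sym gk₀≡φa)))
        ... | inj₂ new′ⱼ∉img = new′ⱼ∉img (subst (_∈ map φ dom) (sym eq) (∈-map⁺ φ b∈dom))

        φ′ : VT → VG
        φ′ u with FinP.any? (λ j → new j ≟ u)
        ... | yes (j , _) = new′ j
        ... | no  _       = φ u

        φ′-new : ∀ j → φ′ (new j) ≡ new′ j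
        φ′-new j with FinP.any? (λ j′ → new j′ ≟ new j)
        ... | yes (j′ , newⱼ′≡newⱼ) = cong new′ (new-inj newⱼ′≡newⱼ)
        ... | no  not-new           = ⊥-elim (not-new (j , refl))

        φ′-old : ∀ {u} → u ∈ dom → φ′ u ≡ φ u
        φ′-old {u} u∈dom with FinP.any? (λ j → new j ≟ u)
        ... | yes (j , newⱼ≡u) = ⊥-elim (new∉dom j (subst (_∈ dom) (sym newⱼ≡u) u∈dom))
        ... | no  _            = refl

        φ′-inj : ∀ {x y} → x ∈ dom′ → y ∈ dom′ → φ′ x ≡ φ′ y → x ≡ y
        φ′-inj x∈ y∈ eq with placed x∈ | placed y∈
        ... | fresh j | fresh j′ =
          cong new (new′-inj (trans (sym (φ′-new j)) (trans eq (φ′-new j′))))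
        ... | fresh j | old y∈dom =
          ⊥-elim (new′∉image j y∈dom (trans (sym (φ′-new j)) (trans eq (φ′-old y∈dom))))
        ... | old x∈dom | fresh j =
          ⊥-elim (new′∉image j x∈dom (trans (sym (φ′-new j)) (trans (sym eq) (φ′-old x∈dom))))
        ... | old x∈dom | old y∈dom =
          φ-inj x∈dom y∈dom (trans (sym (φ′-old x∈dom)) (trans eq (φ′-old y∈dom)))

        φ′-into-S : ∀ {x} → x ∈ dom′ → φ′ x ∈ S
        φ′-into-S x∈ with placed x∈
        ... | fresh j   = subst (_∈ S) (sym (φ′-new j)) (g-inside (punchIn k₀ j))
        ... | old x∈dom = subst (_∈ S) (sym (φ′-old x∈dom)) (φ-into-S x∈dom)

        used′ : List ET
        used′ = f ∷ used

        used′-inside : ∀ {e} → e ∈ used′ → ∀ i → edge T e i ∈ dom′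
        used′-inside (here refl) i with punchView i₀ i
        ... | pivot   = ∈-++⁺ʳ news attached
        ... | other j = ∈-++⁺ˡ (∈-news⁺ j)
        used′-inside (there e∈used) i = ∈-++⁺ʳ news (used-inside e∈used i)

        used′-copied : ∀ {e} → e ∈ used′ → ∃ λ g′ → ∀ i → φ′ (edge T e i) ∈G g′
        used′-copied (here refl) = g , f-onto-g
          where
          f-onto-g : ∀ i → φ′ (edge T f i) ∈G g
          f-onto-g i with punchView i₀ i
          ... | pivot   = k₀ , trans gk₀≡φa (sym (φ′-old attached))
          ... | other j = punchIn k₀ j , sym (φ′-new j)
        used′-copied (there e∈used) with used-copied e∈used
        ... | g′ , e-onto-g′ =
          g′ , λ i → subst (_∈G g′) (sym (φ′-old (used-inside e∈used i))) (e-onto-g′ i)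

        via-f : ∀ {x y} → x ∈T f → y ∈T f → x ≢ y → UsedPath used′ x y
        via-f x∈f y∈f x≢y = 0 , edge-path T f x∈f y∈f x≢y , λ _ → here refl

        used′-linked : ∀ {x y} → x ∈ dom′ → y ∈ dom′ → x ≢ y → UsedPath used′ x y
        used′-linked {x} {y} x∈ y∈ x≢y with placed x∈ | placed y∈
        ... | fresh j | fresh j′ = via-f (punchIn i₀ j , refl) (punchIn i₀ j′ , refl) x≢y
        ... | old x∈dom | old y∈dom with used-linked x∈dom y∈dom x≢y
        ...   | k , q , q-used = k , q , λ j → there (q-used j)
        used′-linked {x} {y} x∈ y∈ x≢y | fresh j | old y∈dom with y ≟ a
        ... | yes refl = via-f (punchIn i₀ j , refl) (i₀ , refl) x≢y
        ... | no  y≢a with used-linked attached y∈dom (λ a≡y → y≢a (sym a≡y))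
        ...   | k , q , q-used = suc k ,
                prepend T (new j) f q (punchIn i₀ j , refl) (i₀ , refl)
                  (λ i vxᵢ≡newⱼ → new∉dom j (subst (_∈ dom) vxᵢ≡newⱼ (path-in-dom q q-used i)))
                  (λ i edᵢ≡f → f∉used (subst (_∈ used) edᵢ≡f (q-used i))) ,
                λ { Fin.zero → here refl ; (Fin.suc i) → there (q-used i) }
        used′-linked {x} {y} x∈ y∈ x≢y | old x∈dom | fresh j with x ≟ a
        ... | yes refl = via-f (i₀ , refl) (punchIn i₀ j , refl) x≢y
        ... | no  x≢a with used-linked x∈dom attached x≢a
        ...   | k , q , q-used = suc k ,
                append T q f (new j) (i₀ , refl) (punchIn i₀ j , refl)
                  (λ i vxᵢ≡newⱼ → new∉dom j (subst (_∈ dom) vxᵢ≡newⱼ (path-in-dom q q-used i)))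
                  (λ i edᵢ≡f → f∉used (subst (_∈ used) edᵢ≡f (q-used i))) ,
                snoc-all (_∈ used′) (ed q) f (λ i → there (q-used i)) (here refl)

        extended : PartialCopy (suc p)
        extended = record
          { dom = dom′ ; dom-unique = dom′-unique ; dom-size = dom′-size
          ; root∈dom = ∈-++⁺ʳ news root∈dom ; φ = φ′ ; φ-inj = φ′-inj ; φ-into-S = φ′-into-S
          ; used = used′ ; used-inside = used′-inside ; used-copied = used′-copied
          ; used-linked = used′-linked }

    step : Outcome ⊎ (suc p ≤ t × PartialCopy (suc p))
    step with FinP.all? (λ y → y ∈? dom)
    ... | yes everywhere = inj₁ (inj₁ (complete-copy everywhere))
    ... | no  incomplete with find-frontier incomplete
    ... | fr with FinP.any? (Attach.receives? fr)
    ... | no  none =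
      inj₁ (inj₂ (φ (Attach.a fr) , φ-into-S (Frontier.attached fr) , Attach.pinned fr none))
    ... | yes (g , g-inside , (k₀ , gk₀≡φa) , g-avoids) =
      inj₂ (Attach.room fr , Attach.Extend.extended fr g g-inside k₀ gk₀≡φa g-avoids)

  -- Growing from a copy with p edges; fuel + p = t bounds the number of further steps.
  grow : ∀ fuel {p} → fuel + p ≡ t → PartialCopy p → Outcome
  grow fuel eq π with step π
  ... | inj₁ done = done
  grow zero       eq π | inj₂ (room , _)  = ⊥-elim (ℕP.<-irrefl eq room)
  grow (suc fuel) eq π | inj₂ (_ , π′)    = grow fuel (trans (ℕP.+-suc fuel _) eq) π′

  outcome : Outcome
  outcome = grow t (ℕP.+-identityʳ t) initial-copy

tree-free-degenerate : ∀ {r₂} t (T G : Hypergraph (suc (suc r₂))) → IsTree T →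
  n T ≡ suc r₂ * t + 1 → ¬ Contains G T → Degenerate G (suc r₂ * (t ∸ 1))
tree-free-degenerate t T G (connected , forest) size T-free S {v₀} v₀∈S
  with TreeGrowth.outcome T G t connected forest size S v₀ v₀∈S
... | inj₁ copy          = ⊥-elim (T-free copy)
... | inj₂ pinned-vertex = pinned-vertex

theorem7 : (r t : ℕ) → 2 ≤ r → 1 ≤ t →
    (T : Hypergraph r) → IsTree T → n T ≡ (r ∸ 1) * t + 1 →
    (G : Hypergraph r) → ¬ Contains G T →
    ChromaticAtMost G (2 * (r ∸ 1) * (t ∸ 1) + 1)
theorem7 (suc zero)      t (s≤s ()) _ _ _ _ _ _
theorem7 (suc (suc r₂)) t _ _ T tree size G T-free =
  degenerate-colourable G (tree-free-degenerate t T G tree size T-free) D<K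
  where
  D<K : suc r₂ * (t ∸ 1) < 2 * suc r₂ * (t ∸ 1) + 1
  D<K = subst (suc r₂ * (t ∸ 1) <_) (ℕP.+-comm 1 (2 * suc r₂ * (t ∸ 1)))
          (s≤s (ℕP.*-monoˡ-≤ (t ∸ 1) (ℕP.m≤m+n (suc r₂) (suc r₂ + 0))))
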